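{- For all CCS$^!$ expressions $R,R'$ and $\alpha\in Act$: if $R\xrightarrow{\alpha}R'$ in the LTS of CCS$^!$ then $dec(R)\,[\alpha\rangle\, dec(R')$ in the unmarked Petri net of CCS$^!$. Moreover, if $dec(R)\,[\alpha\rangle\, M$ for a marking $M$, then there is a CCS$^!$ expression $R'$ with $R\xrightarrow{\alpha}R'$ and $dec(R')=M$.
   Context: CCS$^!$: names $\mathcal A$, agent identifiers $\mathcal K$, output actions $O$; handshake actions $H=\mathcal A\uplus\{\bar a\mid a\in\mathcal A\}$ with $\bar{\bar a}=a$; $Act=H\uplus O\uplus\{\tau\}$. A relabelling is $f:H\to H$ with $f(\bar a)=\overline{f(a)}$, extended by $f(\alpha)=\alpha$ on $O\cup\{\tau\}$. Expressions: agent identifiers $A$ (each with a defining equation $A\stackrel{def}{=}P$), $\alpha.P$, $\sum_{i\in I}P_i$ (any index set), $P|Q$, $P\backslash a$ ($a\in H$), $P[f]$. LTS rules: $\alpha.P\xrightarrow{\alpha}P$; $P_j\xrightarrow{\alpha}P'$, $j\in I$ gives $\sum_{i\in I}P_i\xrightarrow{\alpha}P'$; $P\xrightarrow{\alpha}P'$ gives $P|Q\xrightarrow{\alpha}P'|Q$; $Q\xrightarrow{\alpha}Q'$ gives $P|Q\xrightarrow{\alpha}P|Q'$; $P\xrightarrow{a}P'$, $Q\xrightarrow{\bar a}Q'$ gives $P|Q\xrightarrow{\tau}P'|Q'$; $P\xrightarrow{\alpha}P'$, $a\ne\alpha\ne\bar a$ gives $P\backslash a\xrightarrow{\alpha}P'\backslash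 a$; $P\xrightarrow{\alpha}P'$ gives $P[f]\xrightarrow{f(\alpha)}P'[f]$; $P\xrightarrow{\alpha}P'$ and $A\stackrel{def}{=}P$ give $A\xrightarrow{\alpha}P'$. Petri net semantics: the set of places (grapes) is the smallest set containing $A$, $\alpha.P$, $\sum_{i\in I}P_i$ (for CCS$^!$ expressions $P,P_i$), and $\mu\backslash a$, $\mu|$, $|\mu$, $\mu[f]$ for grapes $\mu$. The map $dec$ from expressions to sets of grapes: $dec(\alpha.P)=\{\alpha.P\}$, $dec(A)=\{A\}$, $dec(\sum_{i\in I}P_i)=\{\sum_{i\in I}P_i\}$, $dec(P|Q)=dec(P)|\cup|dec(Q)$, $dec(P\backslash a)=dec(P)\backslash a$, $dec(P[f])=dec(P)[f]$, where $H|$, $|H$, $H\backslash a$, $H[f]$ apply the constructor elementwise to (multi)sets. Transitions of the unmarked net are triples $H\xrightarrow{\alpha}J$ (meaning a transition $u$ with preset ${}^\bullet u=H$, postset $u^\bullet=J$, label $\alpha$) with $H,J$ multisets of grapes, derived by: $\{\alpha.P\}\xrightarrow{\alpha}dec(P)$; if $(dec(P_j)-K)\xrightarrow{\alpha}J$ with $j\in I$, $K\le dec(P_j)$ then $\{\sum_{i\in I}P_i\}\xrightarrow{\alpha}J+K$; if $H\xrightarrow{\alpha}J$ then $H|\xrightarrow{\alpha}J|$ and $|H\xrightarrow{\alpha}|J$; if $H\xrightarrow{a}J$ and $K\xrightarrow{\bar a}L$ then $H|+|K\xrightarrow{\tau}J|+|L$; if $H\xrightarrow{\alpha}J$ and $a\ne\alpha\ne\bar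 a$ then $H\backslash a\xrightarrow{\alpha}J\backslash a$; if $H\xrightarrow{\alpha}J$ then $H[f]\xrightarrow{f(\alpha)}J[f]$; if $(dec(P)-K)\xrightarrow{\alpha}J$, $A\stackrel{def}{=}P$, $K\le dec(P)$ then $\{A\}\xrightarrow{\alpha}J+K$. For markings (multisets of grapes) $M,M'$, $M[\alpha\rangle M'$ means there is a transition $H\xrightarrow{\alpha}J$ and a multiset $K$ with $M=H+K$ and $M'=J+K$. -}

module Defs where

open import Data.List using (List; []; _∷_; _++_; map; [_])
open import Data.List.Relation.Binary.Permutation.Propositional using (_↭_)
open import Data.Product using (Σ; ∃; _×_; _,_)
open import Relation.Binary.PropositionalEquality using (_≡_; _≢_)

-- Handshake actions H = A ⊎ {ā | a ∈ A}
data Handshake (N : Set) : Set where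
  nm : N → Handshake N
  co : N → Handshake N

bar : {N : Set} → Handshake N → Handshake N
bar (nm a) = co a
bar (co a) = nm a

data Act (N O : Set) : Set where
  hs  : Handshake N → Act N O
  out : O → Act N O
  τ   : Act N O

record Relabelling (N : Set) : Set where
  field
    fn     : Handshake N → Handshake N
    fn-bar : ∀ h → fn (bar h) ≡ bar (fn h)
open Relabelling public

relAct : {N O : Set} → Relabelling N → Act N O → Act N O
relAct f (hs h)  = hs (fn f h)
relAct f (out o) = out o
relAct f τ       = τ

-- CCS^! expressions over names N, agent identifiers K, outputs O.
-- Sums range over an arbitrary index set I : Set.
data Expr (N K O : Set) : Set₁ where
  ident : K → Expr N K O
  pre   : Act N O → Expr N K O → Expr N K O
  sum   : (I : Set) → (I → Expr N K O) → Expr N K O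
  par   : Expr N K O → Expr N K O → Expr N K O
  res   : Expr N K O → Handshake N → Expr N K O
  rel   : Expr N K O → Relabelling N → Expr N K O

-- grapes (places)
data Grape (N K O : Set) : Set₁ where
  g-ident : K → Grape N K O
  g-pre   : Act N O → Expr N K O → Grape N K O
  g-sum   : (I : Set) → (I → Expr N K O) → Grape N K O
  g-res   : Grape N K O → Handshake N → Grape N K O
  g-left  : Grape N K O → Grape N K O
  g-right : Grape N K O → Grape N K O
  g-rel   : Grape N K O → Relabelling N → Grape N K O

module _ {N K O : Set} where

  -- finite multisets of grapes: lists, compared up to permutation (_↭_)
  Multiset : Set₁
  Multiset = List (Grape N K O)

  dec : Expr N K O → Multiset
  dec (ident A)   = [ g-ident A ]
  dec (pre α P)   = [ g-pre α P ]
  dec (sum I P)   = [ g-sum I P ]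
  dec (par P Q)   = map g-left (dec P) ++ map g-right (dec Q)
  dec (res P a)   = map (λ μ → g-res μ a) (dec P)
  dec (rel P f)   = map (λ μ → g-rel μ f) (dec P)

  NotRes : Handshake N → Act N O → Set
  NotRes a α = (α ≢ hs a) × (α ≢ hs (bar a))

  module _ (def : K → Expr N K O) where

    data Step : Expr N K O → Act N O → Expr N K O → Set₁ where
      s-pre  : ∀ {α P} → Step (pre α P) α P
      s-sum  : ∀ {I P α P'} (j : I) → Step (P j) α P' → Step (sum I P) α P'
      s-parL : ∀ {P Q α P'} → Step P α P' → Step (par P Q) α (par P' Q)
      s-parR : ∀ {P Q α Q'} → Step Q α Q' → Step (par P Q) α (par P Q')
      s-com  : ∀ {P Q P' Q' a} → Step P (hs a) P' → Step Q (hs (bar a)) Q' →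
               Step (par P Q) τ (par P' Q')
      s-res  : ∀ {P α P' a} → Step P α P' → NotRes a α → Step (res P a) α (res P' a)
      s-rel  : ∀ {P α P' f} → Step P α P' → Step (rel P f) (relAct f α) (rel P' f)
      s-id   : ∀ {A α P'} → Step (def A) α P' → Step (ident A) α P'

    -- transitions H --α--> J of the unmarked net (pre/postsets as multisets;
    -- the last rule makes the relation a relation on multisets)
    data Trans : Multiset → Act N O → Multiset → Set₁ where
      t-pre  : ∀ {α P} → Trans [ g-pre α P ] α (dec P)
      t-sum  : ∀ {I P α H J Kₘ} (j : I) → H ++ Kₘ ↭ dec (P j) →
               Trans H α J → Trans [ g-sum I P ] α (J ++ Kₘ)
      t-left : ∀ {H α J} → Trans H α J → Trans (map g-left H) α (map g-left J)
      t-right : ∀ {H α J} → Trans H α J → Trans (map g-right H) α (map g-right J)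
      t-com  : ∀ {H J H' J' a} → Trans H (hs a) J → Trans H' (hs (bar a)) J' →
               Trans (map g-left H ++ map g-right H') τ (map g-left J ++ map g-right J')
      t-res  : ∀ {H α J a} → Trans H α J → NotRes a α →
               Trans (map (λ μ → g-res μ a) H) α (map (λ μ → g-res μ a) J)
      t-rel  : ∀ {H α J f} → Trans H α J →
               Trans (map (λ μ → g-rel μ f) H) (relAct f α) (map (λ μ → g-rel μ f) J)
      t-id   : ∀ {A α H J Kₘ} → H ++ Kₘ ↭ dec (def A) →
               Trans H α J → Trans [ g-ident A ] α (J ++ Kₘ)
      t-perm : ∀ {H H' α J J'} → Trans H α J → H ↭ H' → J ↭ J' → Trans H' α J'

    Fire : Multiset → Act N O → Multiset → Set₁
    Fire M α M' = Σ Multiset λ H → Σ Multiset λ J → Σ Multiset λ Kₘ →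
                  Trans H α J × (M ↭ H ++ Kₘ) × (M' ↭ J ++ Kₘ)

module Submission where

--  * Every place in dec R carries the outermost operator of R (dec-op).  So
--    a single place consumed by a transition already determines the shape
--    of R, which gives one inversion lemma per kind of transition (pre-inv,
--    sum-inv, ident-inv, res-inv, rel-inv, par-inv).  For restriction and
--    relabelling the frame is then recovered by inverting an injective map
--    under permutation (map-frame-inv).
--  * A multiset of parallel places splits into its left and right halves
--    (sides, lefts, rights); this splitting is compatible with permutation
--    and lets a frame around a parallel composition be shared out between
--    its two components (sides-inv, sides-join).
--  * Firing is preserved by the net constructions mirroring the LTS rules
--    (fire-map, fire-left, fire-right, fire-com, fire-collapse).
--
-- Soundness ('forward') is induction on the LTS step using the firing
-- lemmas; completeness ('reflect') is induction on the net transition,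
-- generalised to an arbitrary frame, using the inversion lemmas.

open import Defs
open import Data.List.Relation.Binary.Permutation.Propositional using (_↭_)
open import Data.Product using (Σ; _×_)

open import Algebra.Bundles using (CommutativeMonoid)
open import Data.List using (List; []; _∷_; _++_; map; [_]; mapMaybe)
import Data.List.Properties as List
open import Data.List.Membership.Propositional using (_∈_)
open import Data.List.Membership.Propositional.Properties using (∈-map⁺; ∈-++⁺ˡ)
open import Data.List.Relation.Binary.Permutation.Propositional
  using (prep; ↭-refl; ↭-sym; ↭-trans; ↭-reflexive; module PermutationReasoning)
open import Data.List.Relation.Binary.Permutation.Propositional.Properties
  using (++⁺ˡ; ++⁺ʳ; ++⁺; map⁺; ↭-map-inv; ↭-singleton-inv; All-resp-↭; ∈-resp-↭;
         ++-identityʳ; ++-assoc; shift; shifts; mapMaybe-↭; ++-commutativeMonoid)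
open import Data.List.Relation.Unary.All using (All; []; _∷_; lookup; universal)
import Data.List.Relation.Unary.All.Properties as All
open import Data.List.Relation.Unary.Any using (here)
open import Data.Maybe using (Maybe; just; nothing)
open import Data.Product using (∃; ∃₂; _,_)
open import Function.Definitions using (Injective)
open import Relation.Binary.PropositionalEquality using (_≡_; refl; sym; trans; cong₂; module ≡-Reasoning)

map-++-strip : ∀ {a b} {A : Set a} {B : Set b} {f : A → B} → Injective _≡_ _≡_ f →
               ∀ H {X ys} → map f H ++ X ≡ map f ys → ∃ λ Y → ys ≡ H ++ Y × X ≡ map f Y
map-++-strip inj []      e = _ , refl , e
map-++-strip inj (h ∷ H) {ys = y ∷ ys} e
  with e₁ , e₂ ← List.∷-injective e
  with refl ← inj e₁
  with Y , refl , X≡ ← map-++-strip inj H e₂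
  = Y , refl , X≡

map-frame-inv : ∀ {a b} {A : Set a} {B : Set b} {f : A → B} →
                Injective _≡_ _≡_ f → ∀ {D H X} → map f D ↭ map f H ++ X →
                ∃ λ Y → X ≡ map f Y × D ↭ H ++ Y
map-frame-inv {f = f} inj {H = H} p
  with ys , e , q ← ↭-map-inv f p
  with Y , refl , X≡ ← map-++-strip inj H e
  = Y , X≡ , q

module _ {N K O : Set} where

  private
    G = Grape N K O
    E = Expr N K O

  -- The outermost operator of a grape and of an expression.  Restriction and
  -- relabelling keep their parameter, so equal operators have equal parameters.
  data Op : Set where
    op-ident op-pre op-sum op-par : Op
    op-res : Handshake N → Op
    op-rel : Relabelling N → Op

  opG : G → Op
  opG (g-ident _) = op-ident
  opG (g-pre _ _) = op-pre
  opG (g-sum _ _) = op-sum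
  opG (g-res _ a) = op-res a
  opG (g-left _)  = op-par
  opG (g-right _) = op-par
  opG (g-rel _ f) = op-rel f

  opE : E → Op
  opE (ident _) = op-ident
  opE (pre _ _) = op-pre
  opE (sum _ _) = op-sum
  opE (par _ _) = op-par
  opE (res _ a) = op-res a
  opE (rel _ f) = op-rel f

  sides : List G → List G → List G
  sides A B = map g-left A ++ map g-right B

  map-op : ∀ {o} (c : G → G) → (∀ μ → opG (c μ) ≡ o) → ∀ xs → All (λ g → opG g ≡ o) (map c xs)
  map-op c c-op xs = All.map⁺ (universal c-op xs)

  sides-op : ∀ A B → All (λ g → opG g ≡ op-par) (sides A B)
  sides-op A B = All.++⁺ (map-op g-left (λ _ → refl) A) (map-op g-right (λ _ → refl) B)

  dec-op : ∀ R → All (λ g → opG g ≡ opE R) (dec R)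
  dec-op (ident _) = refl ∷ []
  dec-op (pre _ _) = refl ∷ []
  dec-op (sum _ _) = refl ∷ []
  dec-op (par P Q) = sides-op (dec P) (dec Q)
  dec-op (res P a) = map-op (λ μ → g-res μ a) (λ _ → refl) (dec P)
  dec-op (rel P f) = map-op (λ μ → g-rel μ f) (λ _ → refl) (dec P)

  occupant-op : ∀ R {H X x} → x ∈ H → dec R ↭ H ++ X → opG x ≡ opE R
  occupant-op R m p = lookup (dec-op R) (∈-resp-↭ (↭-sym p) (∈-++⁺ˡ m))

  leftOf rightOf : G → Maybe G
  leftOf (g-left μ) = just μ
  leftOf _          = nothing
  rightOf (g-right μ) = just μ
  rightOf _           = nothing

  lefts rights : List G → List G
  lefts  = mapMaybe leftOf
  rights = mapMaybe rightOf

  lefts-sides : ∀ A B → lefts (sides A B) ≡ A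
  lefts-sides A B = begin
    lefts (map g-left A ++ map g-right B)          ≡⟨ List.mapMaybe-++ leftOf (map g-left A) (map g-right B) ⟩
    lefts (map g-left A) ++ lefts (map g-right B)  ≡⟨ cong₂ _++_ (List.mapMaybe-map leftOf g-left A)
                                                                 (List.mapMaybe-map leftOf g-right B) ⟩
    mapMaybe just A ++ mapMaybe (λ _ → nothing) B  ≡⟨ cong₂ _++_ (List.mapMaybe-just A) (List.mapMaybe-nothing B) ⟩
    A ++ []                                        ≡⟨ List.++-identityʳ A ⟩
    A                                              ∎
    where open ≡-Reasoning

  rights-sides : ∀ A B → rights (sides A B) ≡ B
  rights-sides A B = begin
    rights (map g-left A ++ map g-right B)           ≡⟨ List.mapMaybe-++ rightOf (map g-left A) (map g-right B) ⟩
    rights (map g-left A) ++ rights (map g-right B)  ≡⟨ cong₂ _++_ (List.mapMaybe-map rightOf g-left A)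
                                                                   (List.mapMaybe-map rightOf g-right B) ⟩
    mapMaybe (λ _ → nothing) A ++ mapMaybe just B    ≡⟨ cong₂ _++_ (List.mapMaybe-nothing A) (List.mapMaybe-just B) ⟩
    B                                                ∎
    where open ≡-Reasoning

  sides-cancel : ∀ {A B A′ B′} → sides A B ↭ sides A′ B′ → A ↭ A′ × B ↭ B′
  sides-cancel {A} {B} {A′} {B′} p =
      ↭-trans (↭-reflexive (sym (lefts-sides A B)))
        (↭-trans (mapMaybe-↭ leftOf p) (↭-reflexive (lefts-sides A′ B′)))
    , ↭-trans (↭-reflexive (sym (rights-sides A B)))
        (↭-trans (mapMaybe-↭ rightOf p) (↭-reflexive (rights-sides A′ B′)))

  sides-↭ : ∀ {A B A′ B′} → A ↭ A′ → B ↭ B′ → sides A B ↭ sides A′ B′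
  sides-↭ p q = ++⁺ (map⁺ g-left p) (map⁺ g-right q)

  sides-++ : ∀ A B C D → sides A B ++ sides C D ↭ sides (A ++ C) (B ++ D)
  sides-++ A B C D = begin
    (map g-left A ++ map g-right B) ++ (map g-left C ++ map g-right D)
      ↭⟨ interchange (map g-left A) (map g-right B) (map g-left C) (map g-right D) ⟩
    (map g-left A ++ map g-left C) ++ (map g-right B ++ map g-right D)
      ≡⟨ cong₂ _++_ (List.map-++ g-left A C) (List.map-++ g-right B D) ⟨
    sides (A ++ C) (B ++ D) ∎
    where
    open PermutationReasoning
    open import Algebra.Properties.CommutativeSemigroup
      (CommutativeMonoid.commutativeSemigroup (++-commutativeMonoid {A = G}))
      using (interchange)

  left-sides : ∀ A → map g-left A ↭ sides A []
  left-sides A = ↭-sym (++-identityʳ (map g-left A))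

  split-sides : ∀ {M} → All (λ g → opG g ≡ op-par) M → M ↭ sides (lefts M) (rights M)
  split-sides []                           = ↭-refl
  split-sides {g-left μ ∷ M}  (_ ∷ pars)   = prep (g-left μ) (split-sides pars)
  split-sides {g-right μ ∷ M} (_ ∷ pars)   =
    ↭-trans (prep (g-right μ) (split-sides pars)) (↭-sym (shift (g-right μ) (map g-left (lefts M)) _))
  split-sides {g-ident _ ∷ _} (() ∷ _)
  split-sides {g-pre _ _ ∷ _} (() ∷ _)
  split-sides {g-sum _ _ ∷ _} (() ∷ _)
  split-sides {g-res _ _ ∷ _} (() ∷ _)
  split-sides {g-rel _ _ ∷ _} (() ∷ _)

  sides-inv : ∀ {D E A B X} → sides D E ↭ sides A B ++ X →
              D ↭ A ++ lefts X × E ↭ B ++ rights X × X ↭ sides (lefts X) (rights X)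
  sides-inv {D} {E} {A} {B} {X} p =
    let D↭ , E↭ = sides-cancel whole in D↭ , E↭ , X-split
    where
    X-split : X ↭ sides (lefts X) (rights X)
    X-split = split-sides (All.++⁻ʳ (sides A B) (All-resp-↭ p (sides-op D E)))

    whole : sides D E ↭ sides (A ++ lefts X) (B ++ rights X)
    whole = ↭-trans p (↭-trans (++⁺ˡ (sides A B) X-split) (sides-++ A B (lefts X) (rights X)))

  sides-join : ∀ {D E} A B {lX rX X} → D ↭ A ++ lX → E ↭ B ++ rX → X ↭ sides lX rX →
               sides D E ↭ sides A B ++ X
  sides-join A B {lX} {rX} p q x =
    ↭-trans (sides-↭ p q) (↭-trans (↭-sym (sides-++ A B lX rX)) (++⁺ˡ (sides A B) (↭-sym x)))

  pre-inv : ∀ R {α P X} → dec R ↭ g-pre α P ∷ X → R ≡ pre α P × X ≡ []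
  pre-inv R p with occupant-op R {H = [ _ ]} (here refl) p
  pre-inv (pre β Q) p | refl with ↭-singleton-inv (↭-sym p)
  ... | refl = refl , refl

  sum-inv : ∀ R {I P X} → dec R ↭ g-sum I P ∷ X → R ≡ sum I P × X ≡ []
  sum-inv R p with occupant-op R {H = [ _ ]} (here refl) p
  sum-inv (sum J Q) p | refl with ↭-singleton-inv (↭-sym p)
  ... | refl = refl , refl

  ident-inv : ∀ R {A X} → dec R ↭ g-ident A ∷ X → R ≡ ident A × X ≡ []
  ident-inv R p with occupant-op R {H = [ _ ]} (here refl) p
  ident-inv (ident B) p | refl with ↭-singleton-inv (↭-sym p)
  ... | refl = refl , refl

  res-inv : ∀ R {a H X x} → x ∈ H → dec R ↭ map (λ μ → g-res μ a) H ++ X →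
            ∃₂ λ P Y → R ≡ res P a × X ≡ map (λ μ → g-res μ a) Y × dec P ↭ H ++ Y
  res-inv R {a} m p with occupant-op R (∈-map⁺ (λ μ → g-res μ a) m) p
  res-inv (res P b) m p | refl with Y , X≡ , q ← map-frame-inv (λ { refl → refl }) p
    = P , Y , refl , X≡ , q

  rel-inv : ∀ R {f H X x} → x ∈ H → dec R ↭ map (λ μ → g-rel μ f) H ++ X →
            ∃₂ λ P Y → R ≡ rel P f × X ≡ map (λ μ → g-rel μ f) Y × dec P ↭ H ++ Y
  rel-inv R {f} m p with occupant-op R (∈-map⁺ (λ μ → g-rel μ f) m) p
  rel-inv (rel P g) m p | refl with Y , X≡ , q ← map-frame-inv (λ { refl → refl }) p
    = P , Y , refl , X≡ , q

  par-inv : ∀ R A B {X x} → x ∈ sides A B → dec R ↭ sides A B ++ X →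
            Σ E λ P → Σ E λ Q → ∃₂ λ lX rX → R ≡ par P Q ×
              dec P ↭ A ++ lX × dec Q ↭ B ++ rX × X ↭ sides lX rX
  par-inv R A B m p with trans (sym (lookup (sides-op A B) m)) (occupant-op R m p)
  par-inv (par P Q) A B m p | refl with P↭ , Q↭ , X↭ ← sides-inv p
    = P , Q , _ , _ , refl , P↭ , Q↭ , X↭

module _ {N K O : Set} (def : K → Expr N K O) where

  private
    G = Grape N K O
    E = Expr N K O

  map-frame : ∀ (c : G → G) {M H X} → M ↭ H ++ X → map c M ↭ map c H ++ map c X
  map-frame c {H = H} {X} p = ↭-trans (map⁺ c p) (↭-reflexive (List.map-++ c H X))

  fire-trans : ∀ {H α J} → Trans def H α J → Fire def H α J
  fire-trans {H} {J = J} tr = H , J , [] , tr , ↭-sym (++-identityʳ H) , ↭-sym (++-identityʳ J)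

  fire-map : ∀ (c : G → G) {α β M M′} →
             (∀ {H J} → Trans def H α J → Trans def (map c H) β (map c J)) →
             Fire def M α M′ → Fire def (map c M) β (map c M′)
  fire-map c lift (H , J , X , tr , p , q) =
    map c H , map c J , map c X , lift tr , map-frame c {H = H} p , map-frame c {H = J} q

  fire-frameʳ : ∀ {M α M′} Z → Fire def M α M′ → Fire def (M ++ Z) α (M′ ++ Z)
  fire-frameʳ Z (H , J , X , tr , p , q) =
    H , J , X ++ Z , tr , ↭-trans (++⁺ʳ Z p) (++-assoc H X Z) , ↭-trans (++⁺ʳ Z q) (++-assoc J X Z)

  fire-frameˡ : ∀ {M α M′} Z → Fire def M α M′ → Fire def (Z ++ M) α (Z ++ M′)
  fire-frameˡ Z (H , J , X , tr , p , q) =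
    H , J , Z ++ X , tr , ↭-trans (++⁺ˡ Z p) (shifts Z H) , ↭-trans (++⁺ˡ Z q) (shifts Z J)

  fire-left : ∀ {M α M′} B → Fire def M α M′ → Fire def (sides M B) α (sides M′ B)
  fire-left B φ = fire-frameʳ (map g-right B) (fire-map g-left t-left φ)

  fire-right : ∀ {M α M′} A → Fire def M α M′ → Fire def (sides A M) α (sides A M′)
  fire-right A φ = fire-frameˡ (map g-left A) (fire-map g-right t-right φ)

  fire-com : ∀ {M M′ L L′ a} → Fire def M (hs a) M′ → Fire def L (hs (bar a)) L′ →
             Fire def (sides M L) τ (sides M′ L′)
  fire-com (H , J , X , tr , p , q) (H′ , J′ , X′ , tr′ , p′ , q′) =
    sides H H′ , sides J J′ , sides X X′ , t-com tr tr′ ,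
    ↭-trans (sides-↭ p p′) (↭-sym (sides-++ H H′ X X′)) ,
    ↭-trans (sides-↭ q q′) (↭-sym (sides-++ J J′ X X′))

  fire-collapse : ∀ {g D α M} →
                  (∀ {H J X} → H ++ X ↭ D → Trans def H α J → Trans def [ g ] α (J ++ X)) →
                  Fire def D α M → Fire def [ g ] α M
  fire-collapse rule (H , J , X , tr , p , q) = fire-trans (t-perm (rule (↭-sym p) tr) ↭-refl (↭-sym q))

  forward : ∀ {R α R′} → Step def R α R′ → Fire def (dec R) α (dec R′)
  forward s-pre                       = fire-trans t-pre
  forward (s-sum j step)              = fire-collapse (t-sum j) (forward step)
  forward (s-id step)                 = fire-collapse t-id (forward step)
  forward (s-parL {Q = Q} step)       = fire-left (dec Q) (forward step)
  forward (s-parR {P = P} step)       = fire-right (dec P) (forward step)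
  forward (s-com step step′)          = fire-com (forward step) (forward step′)
  forward (s-res {a = a} step ¬res)   = fire-map (λ μ → g-res μ a) (λ tr → t-res tr ¬res) (forward step)
  forward (s-rel {f = f} step)        = fire-map (λ μ → g-rel μ f) t-rel (forward step)

  preset-nonempty : ∀ {H α J} → Trans def H α J → ∃ λ x → x ∈ H
  preset-nonempty t-pre           = _ , here refl
  preset-nonempty (t-sum _ _ _)   = _ , here refl
  preset-nonempty (t-id _ _)      = _ , here refl
  preset-nonempty (t-left tr)     with x , m ← preset-nonempty tr = g-left x , ∈-map⁺ g-left m
  preset-nonempty (t-right tr)    with x , m ← preset-nonempty tr = g-right x , ∈-map⁺ g-right m
  preset-nonempty (t-com tr _)    with x , m ← preset-nonempty tr = g-left x , ∈-++⁺ˡ (∈-map⁺ g-left m)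
  preset-nonempty (t-res {a = a} tr _) with x , m ← preset-nonempty tr = g-res x a , ∈-map⁺ _ m
  preset-nonempty (t-rel {f = f} tr)   with x , m ← preset-nonempty tr = g-rel x f , ∈-map⁺ _ m
  preset-nonempty (t-perm tr H↭ _)     with x , m ← preset-nonempty tr = x , ∈-resp-↭ H↭ m

  reflect : ∀ {H α J} → Trans def H α J → ∀ R X → dec R ↭ H ++ X →
            Σ E λ R′ → Step def R α R′ × dec R′ ↭ J ++ X
  reflect (t-pre {P = P}) R X p
    with refl , refl ← pre-inv R p
    = P , s-pre , ↭-sym (++-identityʳ (dec P))
  reflect (t-sum j P↭ tr) R X p
    with refl , refl ← sum-inv R p
    with R′ , step , r ← reflect tr _ _ (↭-sym P↭)
    = R′ , s-sum j step , ↭-trans r (↭-sym (++-identityʳ _))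
  reflect (t-id A↭ tr) R X p
    with refl , refl ← ident-inv R p
    with R′ , step , r ← reflect tr _ _ (↭-sym A↭)
    = R′ , s-id step , ↭-trans r (↭-sym (++-identityʳ _))
  reflect (t-left {H} {J = J} tr) R X p
    with x , m ← preset-nonempty tr
    with P , Q , lX , rX , refl , P↭ , Q↭ , X↭
           ← par-inv R H [] (∈-++⁺ˡ (∈-map⁺ g-left m)) (↭-trans p (++⁺ʳ X (left-sides H)))
    with P′ , step , r ← reflect tr P lX P↭
    = par P′ Q , s-parL step , ↭-trans (sides-join J [] r Q↭ X↭) (++⁺ʳ X (↭-sym (left-sides J)))
  reflect (t-right {J = J} tr) R X p
    with x , m ← preset-nonempty tr
    with P , Q , lX , rX , refl , P↭ , Q↭ , X↭ ← par-inv R [] _ (∈-map⁺ g-right m) p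
    with Q′ , step , r ← reflect tr Q rX Q↭
    = par P Q′ , s-parR step , sides-join [] J P↭ r X↭
  reflect (t-com {H} {J} {H′} {J′} tr tr′) R X p
    with x , m ← preset-nonempty tr
    with P , Q , lX , rX , refl , P↭ , Q↭ , X↭ ← par-inv R H H′ (∈-++⁺ˡ (∈-map⁺ g-left m)) p
    with P′ , step , r ← reflect tr P lX P↭
    with Q′ , step′ , r′ ← reflect tr′ Q rX Q↭
    = par P′ Q′ , s-com step step′ , sides-join J J′ r r′ X↭
  reflect (t-res {J = J} tr ¬res) R X p
    with x , m ← preset-nonempty tr
    with P , Y , refl , refl , P↭ ← res-inv R m p
    with P′ , step , r ← reflect tr P Y P↭
    = res P′ _ , s-res step ¬res , map-frame _ {H = J} r
  reflect (t-rel {J = J} tr) R X p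
    with x , m ← preset-nonempty tr
    with P , Y , refl , refl , P↭ ← rel-inv R m p
    with P′ , step , r ← reflect tr P Y P↭
    = rel P′ _ , s-rel step , map-frame _ {H = J} r
  reflect (t-perm tr H↭ J↭) R X p
    with R′ , step , r ← reflect tr R X (↭-trans p (++⁺ʳ X (↭-sym H↭)))
    = R′ , step , ↭-trans r (++⁺ʳ X J↭)

theorem4 : (N K O : Set) → (def : K → Expr N K O) →
           ((R R' : Expr N K O) → (α : Act N O) →
             Step def R α R' → Fire def (dec R) α (dec R'))
           ×
           ((R : Expr N K O) → (α : Act N O) → (M : Multiset {N} {K} {O}) →
             Fire def (dec R) α M →
             Σ (Expr N K O) (λ R' → Step def R α R' × (dec R' ↭ M)))
theorem4 N K O def = (λ R R′ α → forward def) , complete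
  where
  complete : ∀ R α M → Fire def (dec R) α M → Σ (Expr N K O) λ R′ → Step def R α R′ × dec R′ ↭ M
  complete R α M (H , J , X , tr , p , q)
    with R′ , step , r ← reflect def tr R X p
    = R′ , step , ↭-trans r (↭-sym q)
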